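{- For a bounded distributive meet semi-lattice $L$, the quadruple $\langle L_*,\tau,\subseteq,L_+\rangle$ is a generalized Priestley space.
   Context: A meet semi-lattice is a poset in which any two elements have a greatest lower bound $\wedge$; it is distributive if whenever $b_1\wedge b_2\leq a$ there exist $c_1\ge b_1$, $c_2\ge b_2$ with $a=c_1\wedge c_2$; bounded means it has top and bottom. A filter is a nonempty upset closed under $\wedge$; a prime filter is a filter $F\ne L$ such that for all filters $F_1,F_2$ with $F_1\cap F_2\subseteq F$ we have $F_1\subseteq F$ or $F_2\subseteq F$. $L_+$ is the set of prime filters, $\sigma(a)=\{y\in L_+:a\in y\}$, $D(L)$ the sublattice of the powerset of $L_+$ of all finite unions of sets $\sigma(a)$. A filter $G$ is optimal if $G=\sigma^{ -1}(P)$ for a prime filter $P$ of the lattice $D(L)$; $L_*$ is the set of optimal filters, $\phi(a)=\{y\in L_*:a\in y\}$, and $\tau$ is the topology on $L_*$ generated by the subbasis $\{\phi(a)\}\cup\{L_*-\phi(b)\}$. A Priestley space is a compact space with a partial order $\le$ such that if $x\not\le y$ there is a clopen upset containing $x$ and not $y$. For a quadruple $X=\langle X,\tau,\le,X_0\rangle$ with $\langle X,\tau,\le\rangle$ a Priestley space and $X_0\subseteq X$, a clopen upset $U$ is admissible if $\mathrm{max}(X-U)\subseteq X_0$; $X^*$ is the set of admissible clopen upsets, and for $x\in X$, $\mathcal{I}_x=\{U\in X^*:x\notin U\}$; $\mathcal{I}_x$ is directed if for all $U,V\in\mathcal{I}_x$ there is $W\in\mathcal{I}_x$ with $U\cup V\subseteq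 W$. $X$ is a generalized Priestley space if: (1) $\langle X,\tau,\le\rangle$ is a Priestley space; (2) $X_0$ is dense in $X$; (3) for each $x\in X$ there is $y\in X_0$ with $x\le y$; (4) $x\in X_0$ iff $\mathcal{I}_x$ is directed; (5) for all $x,y\in X$, $x\le y$ iff every $U\in X^*$ containing $x$ contains $y$. -}

module Defs where

open import Level using (Level; 0ℓ; _⊔_) renaming (suc to lsuc)
open import Data.Product using (Σ; ∃; ∃-syntax; _×_; _,_; proj₁; proj₂)
open import Data.Sum using (_⊎_; inj₁; inj₂)
open import Data.List using (List; []; _∷_)
open import Data.List.Relation.Unary.All using (All)
open import Data.List.Relation.Unary.Any using (Any)
open import Relation.Nullary using (¬_)
open import Relation.Unary using (Pred; _∈_; _⊆_; _∩_; _∪_; ∁)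
open import Relation.Binary using (Rel; IsPartialOrder)
open import Relation.Binary.Definitions using (Minimum)
open import Relation.Binary.Lattice.Bundles using (BoundedMeetSemilattice)
open import Function.Bundles using (_⇔_)

Zorn : (a r ℓ : Level) → Set (lsuc (a ⊔ r ⊔ ℓ))
Zorn a r ℓ = (A : Set a) (_≤_ : Rel A r) →
  (∀ {x} → x ≤ x) → (∀ {x y z} → x ≤ y → y ≤ z → x ≤ z) →
  ((C : Pred A ℓ) → (∀ x y → C x → C y → (x ≤ y) ⊎ (y ≤ x)) →
     ∃[ u ] (∀ x → C x → x ≤ u)) →
  ∃[ m ] (∀ y → m ≤ y → y ≤ m)

module Space {a e r ℓ o z : Level} (X : Set a) (_≈_ : Rel X e) (_≤_ : Rel X r)
             (IsOpen : Pred (Pred X ℓ) o) (X₀ : Pred X z) where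

  IsClopen : Pred X ℓ → Set o
  IsClopen U = IsOpen U × IsOpen (∁ U)

  IsUpset : Pred X ℓ → Set (a ⊔ r ⊔ ℓ)
  IsUpset U = ∀ x y → x ≤ y → U x → U y

  IsClopenUpset : Pred X ℓ → Set (a ⊔ r ⊔ ℓ ⊔ o)
  IsClopenUpset U = IsClopen U × IsUpset U

  IsCompact : (k : Level) → Set (a ⊔ lsuc ℓ ⊔ o ⊔ lsuc k)
  IsCompact k = (𝒰 : Pred (Pred X ℓ) k) → (∀ U → 𝒰 U → IsOpen U) →
    (∀ x → ∃[ U ] (𝒰 U × U x)) →
    ∃[ Us ] (All 𝒰 Us × (∀ x → Any (λ U → U x) Us))

  IsPriestley : (k : Level) → Set _
  IsPriestley k = IsCompact k × IsPartialOrder _≈_ _≤_ ×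
    (∀ x y → ¬ (x ≤ y) → ∃[ U ] (IsClopenUpset U × U x × ¬ U y))

  IsMaxOf : Pred X ℓ → X → Set _
  IsMaxOf S x = S x × (∀ y → S y → x ≤ y → y ≈ x)

  Admissible : Pred X ℓ → Set _
  Admissible U = IsClopenUpset U × (∀ x → IsMaxOf (∁ U) x → X₀ x)

  InI : X → Pred X ℓ → Set _
  InI x U = Admissible U × ¬ U x

  IDirected : X → Set _
  IDirected x = ∀ U V → InI x U → InI x V →
    ∃[ W ] (InI x W × U ⊆ W × V ⊆ W)

  IsGenPriestley : (k : Level) → Set _
  IsGenPriestley k =
    IsPriestley k ×
    (∀ U → IsOpen U → (∃[ x ] U x) → ∃[ x ] (X₀ x × U x)) ×
    (∀ x → ∃[ y ] (X₀ y × x ≤ y)) ×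
    (∀ x → X₀ x ⇔ IDirected x) ×
    (∀ x y → (x ≤ y) ⇔ (∀ U → Admissible U → U x → U y))

module SL (M : BoundedMeetSemilattice 0ℓ 0ℓ 0ℓ) where
  open BoundedMeetSemilattice M

  HasBottom : Set
  HasBottom = ∃[ b ] Minimum _≤_ b

  IsDistributive : Set
  IsDistributive = ∀ a b₁ b₂ → (b₁ ∧ b₂) ≤ a →
    ∃[ c₁ ] ∃[ c₂ ] (b₁ ≤ c₁ × b₂ ≤ c₂ × a ≈ (c₁ ∧ c₂))

  IsFilter : Pred Carrier 0ℓ → Set
  IsFilter F = (∃[ x ] F x) × (∀ x y → x ≤ y → F x → F y) ×
               (∀ x y → F x → F y → F (x ∧ y))

  IsProper : Pred Carrier 0ℓ → Set
  IsProper F = ¬ (∀ x → F x)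

  IsPrimeFilter : Pred Carrier 0ℓ → Set₁
  IsPrimeFilter F = IsFilter F × IsProper F ×
    (∀ F₁ F₂ → IsFilter F₁ → IsFilter F₂ → (F₁ ∩ F₂) ⊆ F →
       (F₁ ⊆ F) ⊎ (F₂ ⊆ F))

  L₊ : Set₁
  L₊ = Σ (Pred Carrier 0ℓ) IsPrimeFilter

  σ : Carrier → Pred L₊ 0ℓ
  σ a y = a ∈ proj₁ y

  InD : Pred (Pred L₊ 0ℓ) (lsuc 0ℓ)
  InD S = ∃[ as ] (∀ y → S y ⇔ Any (λ a → σ a y) as)

  DL : Set₁
  DL = Σ (Pred L₊ 0ℓ) InD

  σ∈D : ∀ a → InD (σ a)
  σ∈D a = (a ∷ []) , λ y → record
    { to = Any.here ; from = λ { (Any.here p) → p }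
    ; to-cong = λ { Relation.Binary.PropositionalEquality.refl → Relation.Binary.PropositionalEquality.refl }
    ; from-cong = λ { Relation.Binary.PropositionalEquality.refl → Relation.Binary.PropositionalEquality.refl } }
    where import Relation.Binary.PropositionalEquality

  IsPrimeFilterD : Pred DL (lsuc 0ℓ) → Set₁
  IsPrimeFilterD P =
    (∃[ S ] P S) ×
    (∃[ S ] ¬ P S) ×
    (∀ S T → proj₁ S ⊆ proj₁ T → P S → P T) ×
    (∀ S T W → (∀ y → proj₁ W y ⇔ (proj₁ S ∩ proj₁ T) y) → P S → P T → P W) ×
    (∀ S T W → (∀ y → proj₁ W y ⇔ (proj₁ S ∪ proj₁ T) y) → P W → P S ⊎ P T)

  IsOptimal : Pred Carrier 0ℓ → Set₂
  IsOptimal G = IsFilter G ×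
    ∃[ P ] (IsPrimeFilterD P × (∀ a → G a ⇔ P (σ a , σ∈D a)))

  L* : Set₂
  L* = Σ (Pred Carrier 0ℓ) IsOptimal

  φ : Carrier → Pred L* 0ℓ
  φ a y = a ∈ proj₁ y

  _⊑_ : Rel L* 0ℓ
  x ⊑ y = proj₁ x ⊆ proj₁ y

  _≐_ : Rel L* 0ℓ
  x ≐ y = (x ⊑ y) × (y ⊑ x)

  Sub : Carrier ⊎ Carrier → Pred L* 0ℓ
  Sub (inj₁ a) = φ a
  Sub (inj₂ b) = ∁ (φ b)

  τOpen : Pred (Pred L* 0ℓ) (lsuc (lsuc 0ℓ))
  τOpen U = ∀ x → U x → ∃[ cs ] (All (λ c → Sub c x) cs ×
                                (∀ y → All (λ c → Sub c y) cs → U y))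

  InL₊ : Pred L* (lsuc 0ℓ)
  InL₊ x = IsPrimeFilter (proj₁ x)

-- Optimal filters are exactly the filters G such that σ s ⊆ σ a₁ ∪ … ∪ σ aₙ and
-- s ∈ G force some aᵢ ∈ G; this property survives unions of chains, which is what
-- Zorn's lemma needs throughout. Compactness comes from a maximal consistent set
-- of subbasic literals, whose positive part would be an uncovered point. A basic
-- open set {x : a ∈ x, b₁ ∉ x, …, bₙ ∉ x} is nonempty iff σ a ⊈ σ b₁ ∪ … ∪ σ bₙ,
-- so it contains a prime filter. Distributivity gives the prime filter theorem,
-- which makes the maximal points outside φ a prime: every φ a is admissible, and
-- these sets recover the order. For prime x, compactness puts each admissible set
-- missing x inside some φ c with c ∉ x, and c's can be joined outside x, so 𝓘ₓ is
-- directed; conversely, directedness of 𝓘ₓ and a maximal point above x outside an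
-- admissible set transfer primeness to x.

module Submission where

open import Defs
open import Level using (Level; 0ℓ; Lift; lift; lower)
open import Axiom.ExcludedMiddle using (ExcludedMiddle)
open import Relation.Binary.Lattice.Bundles using (BoundedMeetSemilattice)
import Relation.Binary.Lattice.Properties.MeetSemilattice
open import Data.Product using (Σ; ∃; ∃-syntax; _×_; _,_; proj₁; proj₂)
open import Data.Sum as Sum using (_⊎_; inj₁; inj₂; [_,_]′)
open import Data.List using (List; []; _∷_; _++_; [_]; map)
open import Data.List.Relation.Unary.All as All using (All; []; _∷_)
import Data.List.Relation.Unary.All.Properties as Allₚ
open import Data.List.Relation.Unary.Any as Any using (Any; here; there)
import Data.List.Relation.Unary.Any.Properties as Anyₚ
open import Data.Empty using (⊥-elim)
open import Function using (id; case_of_)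
open import Relation.Nullary using (¬_; yes; no)
open import Relation.Nullary.Decidable using (True; toWitness; fromWitness; decidable-stable; toSum)
open import Relation.Unary using (Pred; _⊆_; _⊆′_; _∪_; ∁; ｛_｝)
open import Relation.Binary using (Rel; IsPartialOrder)
open import Relation.Binary.Definitions using (Minimum)
open import Relation.Binary.PropositionalEquality using (_≡_; refl)
open import Function.Bundles using (_⇔_; mk⇔; Equivalence)

module Logic (em : ∀ {ℓ} → ExcludedMiddle ℓ) where

  dne : ∀ {p} {P : Set p} → ¬ ¬ P → P
  dne = decidable-stable em

  ¬∀⇒∃¬ : ∀ {a p} {A : Set a} {P : A → Set p} → ¬ (∀ x → P x) → ∃ λ x → ¬ P x
  ¬∀⇒∃¬ ¬∀P = dne λ ¬∃ → ¬∀P λ x → dne λ ¬Px → ¬∃ (x , ¬Px)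

  ¬⊆⇒∃ : ∀ {a p q} {A : Set a} {P : Pred A p} {Q : Pred A q} →
         ¬ (P ⊆ Q) → ∃ λ x → P x × ¬ Q x
  ¬⊆⇒∃ P⊈Q = dne λ ¬∃ → P⊈Q λ {x} Px → dne λ ¬Qx → ¬∃ (x , Px , ¬Qx)

  ¬→⇒×¬ : ∀ {p q} {P : Set p} {Q : Set q} → ¬ (P → Q) → P × ¬ Q
  ¬→⇒×¬ ¬P→Q = dne (λ ¬P → ¬P→Q λ P → ⊥-elim (¬P P)) , λ Q → ¬P→Q λ _ → Q

  -- Propositional resizing: with excluded middle a proposition is equivalent to
  -- a decision bit, which lives in any universe.
  Resize : ∀ {p} (q : Level) → Set p → Set q
  Resize q P = Lift q (True (em {P = P}))

  resize : ∀ {p q} {P : Set p} → P → Resize q P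
  resize x = lift (fromWitness x)

  unresize : ∀ {p q} {P : Set p} → Resize q P → P
  unresize r = toWitness (lower r)

all-in-one-member : ∀ {t r c i q} {T : Set t} {_≼_ : Rel T r} {C : Pred T c} {I : Set i} →
  (∀ x y → C x → C y → (x ≼ y) ⊎ (y ≼ x)) →
  (Q : T → Pred I q) → (∀ {p p′} → p ≼ p′ → Q p ⊆ Q p′) →
  ∀ {p₀} → C p₀ → ∀ is → All (λ j → ∃ λ p → C p × Q p j) is → ∃ λ p → C p × All (Q p) is
all-in-one-member total Q mono {p₀} Cp₀ [] [] = p₀ , Cp₀ , []
all-in-one-member total Q mono Cp₀ (j ∷ is) ((p , Cp , Qpj) ∷ rest)
  with all-in-one-member total Q mono Cp₀ is rest
... | p′ , Cp′ , Qp′is with total p p′ Cp Cp′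
...   | inj₁ p≼p′ = p′ , Cp′ , mono p≼p′ Qpj ∷ Qp′is
...   | inj₂ p′≼p = p , Cp , Qpj ∷ All.map (mono p′≼p) Qp′is

module Filters (M : BoundedMeetSemilattice 0ℓ 0ℓ 0ℓ) where
  open BoundedMeetSemilattice M renaming (refl to ≤-refl; trans to ≤-trans)
  open SL M

  module Filter {F : Pred Carrier 0ℓ} (isFilter : IsFilter F) where

    upward : ∀ {x y} → x ≤ y → F x → F y
    upward x≤y Fx = proj₁ (proj₂ isFilter) _ _ x≤y Fx

    ∧-closed : ∀ {x y} → F x → F y → F (x ∧ y)
    ∧-closed Fx Fy = proj₂ (proj₂ isFilter) _ _ Fx Fy

    ⊤∈ : F ⊤
    ⊤∈ = let (x , Fx) = proj₁ isFilter in upward (maximum x) Fx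

  ↑-isFilter : ∀ c → IsFilter (c ≤_)
  ↑-isFilter c = (c , ≤-refl) , (λ _ _ y≤z c≤y → ≤-trans c≤y y≤z) , (λ _ _ → ∧-greatest)

  IsPrimeFilter-resp-≐ : ∀ {F G} → F ⊆ G → G ⊆ F → IsPrimeFilter F → IsPrimeFilter G
  IsPrimeFilter-resp-≐ F⊆G G⊆F (((x , Fx) , up , meet) , proper , prime) =
    ((x , F⊆G Fx) , (λ x y x≤y Gx → F⊆G (up x y x≤y (G⊆F Gx)))
                  , (λ x y Gx Gy → F⊆G (meet x y (G⊆F Gx) (G⊆F Gy)))) ,
    (λ G-all → proper λ x → G⊆F (G-all x)) ,
    λ F₁ F₂ F₁-filter F₂-filter F₁∩F₂⊆G →
      Sum.map (λ F₁⊆F h → F⊆G (F₁⊆F h)) (λ F₂⊆F h → F⊆G (F₂⊆F h))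
        (prime F₁ F₂ F₁-filter F₂-filter (λ h → G⊆F (F₁∩F₂⊆G h)))

  prime⇒filter : (y : L₊) → IsFilter (proj₁ y)
  prime⇒filter y = proj₁ (proj₂ y)

  σ-mono : ∀ {a b} → a ≤ b → σ a ⊆′ σ b
  σ-mono a≤b y = Filter.upward (prime⇒filter y) a≤b

  σD : Carrier → DL
  σD a = σ a , σ∈D a

  ⋃σ : List Carrier → Pred L₊ 0ℓ
  ⋃σ as y = Any (λ a → σ a y) as

  ⋃σD : List Carrier → DL
  ⋃σD as = ⋃σ as , as , λ _ → mk⇔ id id

  CoverPrime : Pred Carrier 0ℓ → Set₁
  CoverPrime G = ∀ {s} as → σ s ⊆′ ⋃σ as → G s → Any G as

  optimal⇒filter : (x : L*) → IsFilter (proj₁ x)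
  optimal⇒filter x = proj₁ (proj₂ x)

  optimal⇒coverPrime : (x : L*) → CoverPrime (proj₁ x)
  optimal⇒coverPrime (G , _ , P , (_ , (S₀ , ¬PS₀) , upward , _ , prime) , G⇔P) {s} as σs⊆ Gs =
    Any.map (λ {a} → Equivalence.from (G⇔P a))
      (P-⋃σ as (upward (σD s) (⋃σD as) (λ {y} → σs⊆ y) (Equivalence.to (G⇔P s) Gs)))
    where
    P-⋃σ : ∀ as → P (⋃σD as) → Any (λ a → P (σD a)) as
    P-⋃σ [] P∅ = ⊥-elim (¬PS₀ (upward (⋃σD []) S₀ (λ {_} ()) P∅))
    P-⋃σ (a ∷ as) P⋃ =
      [ here , (λ Pas → there (P-⋃σ as Pas)) ]′
        (prime (σD a) (⋃σD as) (⋃σD (a ∷ as)) (λ _ → mk⇔ Any.toSum Any.fromSum) P⋃)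

  optimalPoint : ∀ {G} → IsFilter G → CoverPrime G → L*
  optimalPoint {G} isFilter coverPrime =
    G , isFilter , P , (nonempty , proper , upward , meet , prime) , G⇔P
    where
    open Filter isFilter using (⊤∈; ∧-closed)

    P : Pred DL _
    P S = ∃ λ s → G s × σ s ⊆ proj₁ S

    P-⋃σD : ∀ {S} as → ⋃σ as ⊆′ proj₁ S → Any G as → P S
    P-⋃σD (a ∷ _) ⋃σ⊆S (here Ga) = a , Ga , λ {y} σa → ⋃σ⊆S y (here σa)
    P-⋃σD {S} (_ ∷ as) ⋃σ⊆S (there Gas) = P-⋃σD {S} as (λ y σas → ⋃σ⊆S y (there σas)) Gas

    nonempty : ∃ P
    nonempty = σD ⊤ , ⊤ , ⊤∈ , λ {_} σ⊤ → σ⊤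

    proper : ∃ λ S → ¬ P S
    proper = ⋃σD [] , λ (s , Gs , σs⊆∅) → Anyₚ.¬Any[] (coverPrime [] (λ y → σs⊆∅ {y}) Gs)

    upward : ∀ S T → proj₁ S ⊆ proj₁ T → P S → P T
    upward _ _ S⊆T (s , Gs , σs⊆S) = s , Gs , λ {y} σs → S⊆T (σs⊆S {y} σs)

    meet : ∀ S T W → (∀ y → proj₁ W y ⇔ (proj₁ S y × proj₁ T y)) → P S → P T → P W
    meet _ _ _ W⇔S∩T (s , Gs , σs⊆S) (t , Gt , σt⊆T) =
      s ∧ t , ∧-closed Gs Gt ,
      λ {y} σs∧t → Equivalence.from (W⇔S∩T y)
        (σs⊆S {y} (σ-mono (x∧y≤x s t) y σs∧t) , σt⊆T {y} (σ-mono (x∧y≤y s t) y σs∧t))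

    prime : ∀ S T W → (∀ y → proj₁ W y ⇔ (proj₁ S y ⊎ proj₁ T y)) → P W → P S ⊎ P T
    prime (S , ss , S⇔) (T , ts , T⇔) _ W⇔S∪T (s , Gs , σs⊆W) =
      Sum.map (P-⋃σD {S , ss , S⇔} ss (λ y → Equivalence.from (S⇔ y)))
              (P-⋃σD {T , ts , T⇔} ts (λ y → Equivalence.from (T⇔ y)))
              (Anyₚ.++⁻ ss (coverPrime (ss ++ ts) σs⊆ss++ts Gs))
      where
      σs⊆ss++ts : σ s ⊆′ ⋃σ (ss ++ ts)
      σs⊆ss++ts y σs = [ (λ Sy → Anyₚ.++⁺ˡ (Equivalence.to (S⇔ y) Sy))
                         , (λ Ty → Anyₚ.++⁺ʳ ss (Equivalence.to (T⇔ y) Ty)) ]′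
                         (Equivalence.to (W⇔S∪T y) (σs⊆W {y} σs))

    G⇔P : ∀ a → G a ⇔ P (σD a)
    G⇔P a = mk⇔ (λ Ga → a , Ga , λ {_} σa → σa)
                (λ (s , Gs , σs⊆σa) → Any.head Anyₚ.¬Any[] (coverPrime [ a ] (λ y σs → here (σs⊆σa {y} σs)) Gs))

  prime⇒coverPrime : (y : L₊) → CoverPrime (proj₁ y)
  prime⇒coverPrime y _ σs⊆ ys = σs⊆ y ys

  primePoint : L₊ → L*
  primePoint y = optimalPoint (prime⇒filter y) (prime⇒coverPrime y)

  optimal-avoids-minimum : ∀ {b} → Minimum _≤_ b → (x : L*) → ¬ proj₁ x b
  optimal-avoids-minimum {b} b≤ x xb =
    Anyₚ.¬Any[] (optimal⇒coverPrime x [] (λ y yb → ⊥-elim (proj₁ (proj₂ (proj₂ y))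
      λ c → Filter.upward (prime⇒filter y) (b≤ c) yb)) xb)

  Literal : Set
  Literal = Carrier ⊎ Carrier

  _⊨_ : L* → List Literal → Set
  x ⊨ ls = All (λ l → Sub l x) ls

  Sub-open : ∀ l → τOpen (Sub l)
  Sub-open l x x∈l = l ∷ [] , x∈l ∷ [] , λ { _ (y∈l ∷ []) → y∈l }

  ⋀⁺ : List Literal → Carrier
  ⋀⁺ [] = ⊤
  ⋀⁺ (inj₁ a ∷ ls) = a ∧ ⋀⁺ ls
  ⋀⁺ (inj₂ _ ∷ ls) = ⋀⁺ ls

  negatives : List Literal → List Carrier
  negatives [] = []
  negatives (inj₁ _ ∷ ls) = negatives ls
  negatives (inj₂ b ∷ ls) = b ∷ negatives ls

  ⊨⇔ : ∀ x ls → x ⊨ ls ⇔ (proj₁ x (⋀⁺ ls) × ¬ Any (proj₁ x) (negatives ls))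
  ⊨⇔ x ls = mk⇔ (λ x⊨ls → ⋀⁺∈ ls x⊨ls , Allₚ.All¬⇒¬Any (negatives∉ ls x⊨ls))
                (λ (x∋⋀⁺ , x∌negatives) → ⊨-intro ls x∋⋀⁺ (Allₚ.¬Any⇒All¬ _ x∌negatives))
    where
    open Filter (optimal⇒filter x)

    ⋀⁺∈ : ∀ ls → x ⊨ ls → proj₁ x (⋀⁺ ls)
    ⋀⁺∈ [] [] = ⊤∈
    ⋀⁺∈ (inj₁ _ ∷ ls) (xa ∷ x⊨ls) = ∧-closed xa (⋀⁺∈ ls x⊨ls)
    ⋀⁺∈ (inj₂ _ ∷ ls) (_ ∷ x⊨ls) = ⋀⁺∈ ls x⊨ls

    negatives∉ : ∀ ls → x ⊨ ls → All (λ b → ¬ proj₁ x b) (negatives ls)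
    negatives∉ [] [] = []
    negatives∉ (inj₁ _ ∷ ls) (_ ∷ x⊨ls) = negatives∉ ls x⊨ls
    negatives∉ (inj₂ _ ∷ ls) (x∌b ∷ x⊨ls) = x∌b ∷ negatives∉ ls x⊨ls

    ⊨-intro : ∀ ls → proj₁ x (⋀⁺ ls) → All (λ b → ¬ proj₁ x b) (negatives ls) → x ⊨ ls
    ⊨-intro [] _ [] = []
    ⊨-intro (inj₁ a ∷ ls) x∋⋀⁺ x∌negatives =
      upward (x∧y≤x _ _) x∋⋀⁺ ∷ ⊨-intro ls (upward (x∧y≤y _ _) x∋⋀⁺) x∌negatives
    ⊨-intro (inj₂ b ∷ ls) x∋⋀⁺ (x∌b ∷ x∌negatives) = x∌b ∷ ⊨-intro ls x∋⋀⁺ x∌negatives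

module ClassicalFilters (em : ∀ {ℓ} → ExcludedMiddle ℓ) (M : BoundedMeetSemilattice 0ℓ 0ℓ 0ℓ) where
  open BoundedMeetSemilattice M using (Carrier; ⊤; _≤_; _∧_) renaming (refl to ≤-refl)
  open SL M
  open Filters M
  open Logic em

  prime-avoids-upper-bound : ∀ {Q} → IsPrimeFilter Q → ∀ {a b} → ¬ Q a → ¬ Q b →
    ∃ λ d → a ≤ d × b ≤ d × ¬ Q d
  prime-avoids-upper-bound {Q} (_ , _ , prime) {a} {b} Q∌a Q∌b = dne λ ¬∃ →
    [ (λ ↑a⊆Q → Q∌a (↑a⊆Q ≤-refl)) , (λ ↑b⊆Q → Q∌b (↑b⊆Q ≤-refl)) ]′
      (prime (a ≤_) (b ≤_) (↑-isFilter a) (↑-isFilter b)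
        λ {d} (a≤d , b≤d) → dne λ Q∌d → ¬∃ (d , a≤d , b≤d , Q∌d))

  -- The base G keeps the union of the empty chain a filter.
  module ChainUnion {t c} {T : Set t} (F : T → Pred Carrier 0ℓ) (C : Pred T c)
    (total : ∀ p q → C p → C q → (F p ⊆ F q) ⊎ (F q ⊆ F p))
    {G : Pred Carrier 0ℓ} (G⊆F : ∀ {p} → C p → G ⊆ F p) where

    ⋃ : Pred Carrier 0ℓ
    ⋃ a = Resize 0ℓ (G a ⊎ ∃ λ p → C p × F p a)

    G⊆⋃ : G ⊆ ⋃
    G⊆⋃ Ga = resize (inj₁ Ga)

    F⊆⋃ : ∀ {p} → C p → F p ⊆ ⋃
    F⊆⋃ {p} Cp Fpa = resize (inj₂ (p , Cp , Fpa))

    ⋃-isFilter : IsFilter G → (∀ {p} → C p → IsFilter (F p)) → IsFilter ⋃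
    ⋃-isFilter G-filter F-filter =
      (⊤ , G⊆⋃ (Filter.⊤∈ G-filter)) , ⋃-upward , ⋃-∧-closed
      where
      ⋃-upward : ∀ a b → a ≤ b → ⋃ a → ⋃ b
      ⋃-upward _ _ a≤b ⋃a with unresize ⋃a
      ... | inj₁ Ga = G⊆⋃ (Filter.upward G-filter a≤b Ga)
      ... | inj₂ (p , Cp , Fpa) = F⊆⋃ Cp (Filter.upward (F-filter Cp) a≤b Fpa)

      ∧-in : ∀ {p a b} → C p → F p a → F p b → ⋃ (a ∧ b)
      ∧-in Cp Fpa Fpb = F⊆⋃ Cp (Filter.∧-closed (F-filter Cp) Fpa Fpb)

      ⋃-∧-closed : ∀ a b → ⋃ a → ⋃ b → ⋃ (a ∧ b)
      ⋃-∧-closed _ _ ⋃a ⋃b with unresize ⋃a | unresize ⋃b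
      ... | inj₁ Ga | inj₁ Gb = G⊆⋃ (Filter.∧-closed G-filter Ga Gb)
      ... | inj₁ Ga | inj₂ (q , Cq , Fqb) = ∧-in Cq (G⊆F Cq Ga) Fqb
      ... | inj₂ (p , Cp , Fpa) | inj₁ Gb = ∧-in Cp Fpa (G⊆F Cp Gb)
      ... | inj₂ (p , Cp , Fpa) | inj₂ (q , Cq , Fqb) with total p q Cp Cq
      ...   | inj₁ Fp⊆Fq = ∧-in Cq (Fp⊆Fq Fpa) Fqb
      ...   | inj₂ Fq⊆Fp = ∧-in Cp Fpa (Fq⊆Fp Fqb)

    ⋃-coverPrime : CoverPrime G → (∀ {p} → C p → CoverPrime (F p)) → CoverPrime ⋃
    ⋃-coverPrime G-coverPrime F-coverPrime as σs⊆ ⋃s with unresize ⋃s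
    ... | inj₁ Gs = Any.map G⊆⋃ (G-coverPrime as σs⊆ Gs)
    ... | inj₂ (p , Cp , Fps) = Any.map (F⊆⋃ Cp) (F-coverPrime Cp as σs⊆ Fps)

module PrimeFilterTheorem (em : ∀ {ℓ} → ExcludedMiddle ℓ) (zorn : ∀ {a r ℓ} → Zorn a r ℓ)
  (M : BoundedMeetSemilattice 0ℓ 0ℓ 0ℓ) (distributive : SL.IsDistributive M) where
  open BoundedMeetSemilattice M renaming (refl to ≤-refl; trans to ≤-trans)
  open Relation.Binary.Lattice.Properties.MeetSemilattice meetSemilattice using (∧-monotonic)
  open SL M
  open Filters M
  open ClassicalFilters em M
  open Logic em

  -- In a distributive lattice a ≥ g ∧ (a₁ ∨ a₂); distributivity supplies a
  -- replacement for the missing join.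
  ∈-by-cases : ∀ {F g a a₁ a₂} → IsFilter F → F g → g ∧ a₁ ≤ a → g ∧ a₂ ≤ a →
    (∀ {d} → a₁ ≤ d → a₂ ≤ d → F d) → F a
  ∈-by-cases {g = g} {a} {a₁} {a₂} isFilter Fg g∧a₁≤a g∧a₂≤a ↑a₁∩↑a₂⊆F =
    let (c₁ , c₂ , g≤c₁ , a₁≤c₂ , a≈c₁∧c₂) = distributive a g a₁ g∧a₁≤a
        g∧a₂≤c₂ = ≤-trans g∧a₂≤a (≤-trans (reflexive a≈c₁∧c₂) (x∧y≤y c₁ c₂))
        (d₁ , d₂ , g≤d₁ , a₂≤d₂ , c₂≈d₁∧d₂) = distributive c₂ g a₂ g∧a₂≤c₂
        a₁≤d₂ = ≤-trans a₁≤c₂ (≤-trans (reflexive c₂≈d₁∧d₂) (x∧y≤y d₁ d₂))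
        Fc₂ = upward (reflexive (Eq.sym c₂≈d₁∧d₂))
                (∧-closed (upward g≤d₁ Fg) (↑a₁∩↑a₂⊆F a₁≤d₂ a₂≤d₂))
    in upward (reflexive (Eq.sym a≈c₁∧c₂)) (∧-closed (upward g≤c₁ Fg) Fc₂)
    where open Filter isFilter

  adjoin : Pred Carrier 0ℓ → Carrier → Pred Carrier 0ℓ
  adjoin F b c = ∃ λ q → F q × q ∧ b ≤ c

  adjoin-isFilter : ∀ {F} → IsFilter F → ∀ b → IsFilter (adjoin F b)
  adjoin-isFilter isFilter b =
    (b , ⊤ , ⊤∈ , x∧y≤y ⊤ b) ,
    (λ _ _ c≤c′ (q , Fq , q∧b≤c) → q , Fq , ≤-trans q∧b≤c c≤c′) ,
    (λ _ _ (q , Fq , q∧b≤c) (q′ , Fq′ , q′∧b≤c′) →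
      q ∧ q′ , ∧-closed Fq Fq′ ,
      ∧-greatest (≤-trans (∧-monotonic (x∧y≤x q q′) ≤-refl) q∧b≤c)
                 (≤-trans (∧-monotonic (x∧y≤y q q′) ≤-refl) q′∧b≤c′))
    where open Filter isFilter

  maximal-avoiding⇒prime : ∀ {F a} → IsFilter F → ¬ F a →
    (∀ F′ → IsFilter F′ → F ⊆ F′ → ¬ F′ a → F′ ⊆ F) → IsPrimeFilter F
  maximal-avoiding⇒prime {F} {a} isFilter F∌a maximal =
    isFilter , (λ F-all → F∌a (F-all a)) , prime
    where
    open Filter isFilter

    outside⇒meet-below : ∀ {b} → ¬ F b → ∃ λ q → F q × q ∧ b ≤ a
    outside⇒meet-below {b} F∌b = dne λ ¬∃ →
      F∌b (maximal (adjoin F b) (adjoin-isFilter isFilter b)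
             (λ {q} Fq → q , Fq , x∧y≤x q b) ¬∃
             (⊤ , ⊤∈ , x∧y≤y ⊤ b))

    prime : ∀ F₁ F₂ → IsFilter F₁ → IsFilter F₂ → (λ x → F₁ x × F₂ x) ⊆ F →
            (F₁ ⊆ F) ⊎ (F₂ ⊆ F)
    prime F₁ F₂ F₁-filter F₂-filter F₁∩F₂⊆F = dne {P = (F₁ ⊆ F) ⊎ (F₂ ⊆ F)} λ neither →
      let (a₁ , F₁a₁ , F∌a₁) = ¬⊆⇒∃ {P = F₁} {Q = F} (λ F₁⊆F → neither (inj₁ F₁⊆F))
          (a₂ , F₂a₂ , F∌a₂) = ¬⊆⇒∃ {P = F₂} {Q = F} (λ F₂⊆F → neither (inj₂ F₂⊆F))
          (q₁ , Fq₁ , q₁∧a₁≤a) = outside⇒meet-below F∌a₁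
          (q₂ , Fq₂ , q₂∧a₂≤a) = outside⇒meet-below F∌a₂
      in F∌a (∈-by-cases isFilter (∧-closed Fq₁ Fq₂)
                (≤-trans (∧-monotonic (x∧y≤x q₁ q₂) ≤-refl) q₁∧a₁≤a)
                (≤-trans (∧-monotonic (x∧y≤y q₁ q₂) ≤-refl) q₂∧a₂≤a)
                λ a₁≤d a₂≤d → F₁∩F₂⊆F (Filter.upward F₁-filter a₁≤d F₁a₁ ,
                                       Filter.upward F₂-filter a₂≤d F₂a₂))

  prime-filter-theorem : ∀ {G a} → IsFilter G → ¬ G a →
    ∃ λ Q → IsPrimeFilter Q × G ⊆ Q × ¬ Q a
  prime-filter-theorem {G} {a} G-filter G∌a =
    let ((F , F-filter , G⊆F , F∌a) , maximal) =
          zorn Avoiding (λ p q → proj₁ p ⊆ proj₁ q) id (λ p⊆q q⊆r x → q⊆r (p⊆q x)) chain-bound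
    in F , maximal-avoiding⇒prime F-filter F∌a
             (λ F′ F′-filter F⊆F′ F′∌a →
               maximal (F′ , F′-filter , (λ Gx → F⊆F′ (G⊆F Gx)) , F′∌a) F⊆F′)
         , G⊆F , F∌a
    where
    Avoiding : Set₁
    Avoiding = Σ (Pred Carrier 0ℓ) λ F → IsFilter F × G ⊆ F × ¬ F a

    chain-bound : (C : Pred Avoiding 0ℓ) →
      (∀ p q → C p → C q → (proj₁ p ⊆ proj₁ q) ⊎ (proj₁ q ⊆ proj₁ p)) →
      ∃ λ u → ∀ p → C p → proj₁ p ⊆ proj₁ u
    chain-bound C total =
      (⋃ , ⋃-isFilter G-filter (λ {p} _ → proj₁ (proj₂ p)) , (λ {x} → G⊆⋃ {x}) , ⋃∌a) , λ _ Cp {x} → F⊆⋃ Cp {x}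
      where
      open ChainUnion proj₁ C total (λ {p} _ → proj₁ (proj₂ (proj₂ p)))
      ⋃∌a : ¬ ⋃ a
      ⋃∌a ⋃a with unresize ⋃a
      ... | inj₁ Ga = G∌a Ga
      ... | inj₂ ((_ , _ , _ , F∌a) , _ , Fa) = F∌a Fa

module Compactness (em : ∀ {ℓ} → ExcludedMiddle ℓ) (zorn : ∀ {a r ℓ} → Zorn a r ℓ)
  (M : BoundedMeetSemilattice 0ℓ 0ℓ 0ℓ) where
  open BoundedMeetSemilattice M using (Carrier; ⊤; _∧_)
  open SL M
  open Filters M
  open Logic em
  open Space L* _≐_ _⊑_ τOpen InL₊

  strip : ∀ {P : Pred Literal 0ℓ} l ls → All (P ∪ ｛ l ｝) ls →
    ∃ λ ls′ → All P ls′ × (∀ x → Sub l x → x ⊨ ls′ → x ⊨ ls)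
  strip l [] [] = [] , [] , λ _ _ _ → []
  strip l (l′ ∷ ls) (inj₁ Pl′ ∷ rest) =
    let (ls′ , Pls′ , ⊨ls) = strip l ls rest
    in l′ ∷ ls′ , Pl′ ∷ Pls′ , λ { x x∈l (x∈l′ ∷ x⊨ls′) → x∈l′ ∷ ⊨ls x x∈l x⊨ls′ }
  strip l (l′ ∷ ls) (inj₂ refl ∷ rest) =
    let (ls′ , Pls′ , ⊨ls) = strip l ls rest
    in ls′ , Pls′ , λ x x∈l x⊨ls′ → x∈l ∷ ⊨ls x x∈l x⊨ls′

  module _ {k} (𝒰 : Pred (Pred L* 0ℓ) k) where

    Avoids : L* → List (Pred L* 0ℓ) → Set₂
    Avoids x Us = All (λ U → ¬ U x) Us

    Consistent : Pred Literal 0ℓ → Set _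
    Consistent P = ∀ ls Us → All P ls → All 𝒰 Us → ∃ λ x → x ⊨ ls × Avoids x Us

    ConsistentSet : Set _
    ConsistentSet = Σ (Pred Literal 0ℓ) Consistent

    consistent-extends : ∀ {P} → Consistent P → ∀ l₁ l₂ → (∀ x → Sub l₁ x ⊎ Sub l₂ x) →
      Consistent (P ∪ ｛ l₁ ｝) ⊎ Consistent (P ∪ ｛ l₂ ｝)
    consistent-extends {P} P-consistent l₁ l₂ l₁∨l₂ with em {P = Consistent (P ∪ ｛ l₁ ｝)}
    ... | yes consistent₁ = inj₁ consistent₁
    ... | no ¬consistent₁ = inj₂ λ ls Us P₂ls 𝒰Us → dne λ ¬∃ → ¬consistent₁ λ ls′ Us′ P₁ls′ 𝒰Us′ →
      let (ls₂ , Pls₂ , ⊨ls) = strip l₂ ls P₂ls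
          (ls₁ , Pls₁ , ⊨ls′) = strip l₁ ls′ P₁ls′
          (x , x⊨ , x-avoids) = P-consistent (ls₂ ++ ls₁) (Us ++ Us′)
                                  (Allₚ.++⁺ Pls₂ Pls₁) (Allₚ.++⁺ 𝒰Us 𝒰Us′)
          (x⊨ls₂ , x⊨ls₁) = Allₚ.++⁻ ls₂ x⊨
          (x-avoids-Us , x-avoids-Us′) = Allₚ.++⁻ Us x-avoids
      in [ (λ x∈l₁ → x , ⊨ls′ x x∈l₁ x⊨ls₁ , x-avoids-Us′)
         , (λ x∈l₂ → ⊥-elim (¬∃ (x , ⊨ls x x∈l₂ x⊨ls₂ , x-avoids-Us))) ]′ (l₁∨l₂ x)

    -- A maximal consistent set of literals decides every a; its positive part is
    -- an optimal filter, and that point lies in no member of 𝒰.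
    module MaximalConsistent {P} (P-consistent : Consistent P)
      (maximal : ∀ Q → Consistent Q → P ⊆ Q → Q ⊆ P) where

      In : Pred Carrier 0ℓ
      In a = P (inj₁ a)

      decided : ∀ a → P (inj₁ a) ⊎ P (inj₂ a)
      decided a = Sum.map (λ c → maximal _ c inj₁ (inj₂ refl)) (λ c → maximal _ c inj₁ (inj₂ refl))
        (consistent-extends P-consistent (inj₁ a) (inj₂ a) (λ x → toSum em))

      ¬In⇒out : ∀ {a} → ¬ In a → P (inj₂ a)
      ¬In⇒out {a} ¬Ina = [ (λ Ina → ⊥-elim (¬Ina Ina)) , id ]′ (decided a)

      witness : ∀ ls → All P ls → ∃ λ x → x ⊨ ls
      witness ls Pls = let (x , x⊨ls , _) = P-consistent ls [] Pls [] in x , x⊨ls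

      In-isFilter : IsFilter In
      In-isFilter =
        (⊤ , dne λ ¬In⊤ →
          case witness (inj₂ ⊤ ∷ []) (¬In⇒out ¬In⊤ ∷ []) of λ where
            (x , x∌⊤ ∷ []) → x∌⊤ (Filter.⊤∈ (optimal⇒filter x))) ,
        (λ a b a≤b Ina → dne λ ¬Inb →
          case witness (inj₁ a ∷ inj₂ b ∷ []) (Ina ∷ ¬In⇒out ¬Inb ∷ []) of λ where
            (x , xa ∷ x∌b ∷ []) → x∌b (Filter.upward (optimal⇒filter x) a≤b xa)) ,
        (λ a b Ina Inb → dne λ ¬Ina∧b →
          case witness (inj₁ a ∷ inj₁ b ∷ inj₂ (a ∧ b) ∷ []) (Ina ∷ Inb ∷ ¬In⇒out ¬Ina∧b ∷ []) of λ where
            (x , xa ∷ xb ∷ x∌a∧b ∷ []) → x∌a∧b (Filter.∧-closed (optimal⇒filter x) xa xb))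

      In-coverPrime : CoverPrime In
      In-coverPrime {s} as σs⊆ Ins = dne λ ¬Any →
        case witness (inj₁ s ∷ map inj₂ as)
                     (Ins ∷ Allₚ.map⁺ (All.map ¬In⇒out (Allₚ.¬Any⇒All¬ as ¬Any))) of λ where
          (x , xs ∷ x⊨¬as) → Allₚ.All¬⇒¬Any (Allₚ.map⁻ x⊨¬as) (optimal⇒coverPrime x as σs⊆ xs)

      point : L*
      point = optimalPoint In-isFilter In-coverPrime

      point⊨⇒All : ∀ ls → point ⊨ ls → All P ls
      point⊨⇒All [] [] = []
      point⊨⇒All (inj₁ a ∷ ls) (Ina ∷ point⊨ls) = Ina ∷ point⊨⇒All ls point⊨ls
      point⊨⇒All (inj₂ a ∷ ls) (¬Ina ∷ point⊨ls) = ¬In⇒out ¬Ina ∷ point⊨⇒All ls point⊨ls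

      ¬covered : (∀ U → 𝒰 U → τOpen U) → ¬ (∃ λ U → 𝒰 U × U point)
      ¬covered 𝒰-open (U , 𝒰U , U-point) =
        let (ls , point⊨ls , ⊨ls⊆U) = 𝒰-open U 𝒰U point U-point
            (x , x⊨ls , x-avoids-U) = P-consistent ls (U ∷ []) (point⊨⇒All ls point⊨ls) (𝒰U ∷ [])
        in All.head x-avoids-U (⊨ls⊆U x x⊨ls)

    chain-bound : ¬ (∃[ Us ] (All 𝒰 Us × (∀ x → Any (λ U → U x) Us))) →
      (C : Pred ConsistentSet 0ℓ) →
      (∀ p q → C p → C q → (proj₁ p ⊆ proj₁ q) ⊎ (proj₁ q ⊆ proj₁ p)) →
      Σ ConsistentSet λ u → ∀ p → C p → proj₁ p ⊆ proj₁ u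
    chain-bound no-finite-subcover C total = (⋃ , ⋃-consistent) , λ p Cp Pl → resize (p , Cp , Pl)
      where
      ⋃ : Pred Literal 0ℓ
      ⋃ l = Resize 0ℓ (∃ λ p → C p × proj₁ p l)

      ⋃-consistent : Consistent ⋃
      ⋃-consistent [] Us [] 𝒰Us = dne λ ¬∃ →
        no-finite-subcover (Us , 𝒰Us , λ x → dne λ ¬Any → ¬∃ (x , [] , Allₚ.¬Any⇒All¬ Us ¬Any))
      ⋃-consistent (l ∷ ls) Us ⋃ls 𝒰Us =
        let (_ , Cp₀ , _) = unresize (All.head ⋃ls)
            (p , _ , Pls) = all-in-one-member total proj₁ (λ p⊆q → p⊆q) Cp₀ (l ∷ ls)
                              (All.map unresize ⋃ls)
        in proj₂ p (l ∷ ls) Us Pls 𝒰Us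

  compact : ∀ k → IsCompact k
  compact k 𝒰 𝒰-open covers = dne λ no-finite-subcover →
    let ((_ , P-consistent) , maximal) =
          zorn (ConsistentSet 𝒰) (λ p q → proj₁ p ⊆ proj₁ q) id (λ p⊆q q⊆r x → q⊆r (p⊆q x))
               (chain-bound 𝒰 no-finite-subcover)
        open MaximalConsistent 𝒰 P-consistent (λ Q Q-consistent P⊆Q → maximal (Q , Q-consistent) P⊆Q)
    in ¬covered 𝒰-open (covers point)

module Density (em : ∀ {ℓ} → ExcludedMiddle ℓ) (M : BoundedMeetSemilattice 0ℓ 0ℓ 0ℓ) where
  open SL M
  open Filters M
  open Logic em

  prime-dense : ∀ U → τOpen U → ∃ U → ∃ λ x → InL₊ x × U x
  prime-dense U U-open (x , Ux) =
    let (ls , x⊨ls , ⊨ls⊆U) = U-open x Ux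
        (x∋⋀⁺ , x∌negatives) = Equivalence.to (⊨⇔ x ls) x⊨ls
        (p , σ⋀⁺⊈⋃σnegatives) = ¬∀⇒∃¬ λ σ⋀⁺⊆ →
                                  x∌negatives (optimal⇒coverPrime x (negatives ls) σ⋀⁺⊆ x∋⋀⁺)
    in primePoint p , proj₂ p ,
       ⊨ls⊆U (primePoint p) (Equivalence.from (⊨⇔ (primePoint p) ls) (¬→⇒×¬ σ⋀⁺⊈⋃σnegatives))

module MaximalPoints (em : ∀ {ℓ} → ExcludedMiddle ℓ) (zorn : ∀ {a r ℓ} → Zorn a r ℓ)
  (M : BoundedMeetSemilattice 0ℓ 0ℓ 0ℓ) where
  open SL M
  open Filters M
  open ClassicalFilters em M
  open Logic em
  open Space L* _≐_ _⊑_ τOpen InL₊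

  closed-maximal-above : ∀ W → τOpen W → ∀ x → ¬ W x → ∃ λ m → x ⊑ m × IsMaxOf (∁ W) m
  closed-maximal-above W W-open x ¬Wx =
    let ((m , x⊑m , ¬Wm) , maximal) =
          zorn Above (λ p q → proj₁ p ⊑ proj₁ q) id (λ p⊑q q⊑r y → q⊑r (p⊑q y)) chain-bound
    in m , x⊑m , ¬Wm , λ y ¬Wy m⊑y → maximal (y , (λ xa → m⊑y (x⊑m xa)) , ¬Wy) m⊑y , m⊑y
    where
    Above : Set₂
    Above = Σ L* λ y → x ⊑ y × ¬ W y

    chain-bound : (C : Pred Above 0ℓ) →
      (∀ p q → C p → C q → (proj₁ p ⊑ proj₁ q) ⊎ (proj₁ q ⊑ proj₁ p)) →
      Σ Above λ u → ∀ p → C p → proj₁ p ⊑ proj₁ u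
    chain-bound C total = (point , G⊆⋃ , ¬W-point) , λ _ Cp → F⊆⋃ Cp
      where
      open ChainUnion (λ p → proj₁ (proj₁ p)) C total (λ {p} _ → proj₁ (proj₂ p))

      point : L*
      point = optimalPoint (⋃-isFilter (optimal⇒filter x) (λ {p} _ → optimal⇒filter (proj₁ p)))
                           (⋃-coverPrime (optimal⇒coverPrime x) (λ {p} _ → optimal⇒coverPrime (proj₁ p)))

      -- The basic neighbourhood of the union inside W is met by x or by a member
      -- of the chain: whichever contains the meet of its positive literals.
      ¬W-point : ¬ W point
      ¬W-point W-point =
        let (ls , point⊨ls , ⊨ls⊆W) = W-open point W-point
            (⋃∋⋀⁺ , ⋃∌negatives) = Equivalence.to (⊨⇔ point ls) point⊨ls
            W-below : ∀ y → proj₁ y ⊆ ⋃ → proj₁ y (⋀⁺ ls) → W y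
            W-below y y⊆⋃ y∋⋀⁺ = ⊨ls⊆W y (Equivalence.from (⊨⇔ y ls)
                                   (y∋⋀⁺ , λ y∋negative → ⋃∌negatives (Any.map y⊆⋃ y∋negative)))
        in [ (λ x∋⋀⁺ → ¬Wx (W-below x G⊆⋃ x∋⋀⁺))
           , (λ ((p , _ , ¬Wp) , Cp , p∋⋀⁺) → ¬Wp (W-below p (F⊆⋃ Cp) p∋⋀⁺)) ]′ (unresize ⋃∋⋀⁺)

module GeneralizedPriestley (em : ∀ {ℓ} → ExcludedMiddle ℓ) (zorn : ∀ {a r ℓ} → Zorn a r ℓ)
  (M : BoundedMeetSemilattice 0ℓ 0ℓ 0ℓ) (bottom : SL.HasBottom M) (distributive : SL.IsDistributive M) where
  open SL M
  open Filters M
  open ClassicalFilters em M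
  open PrimeFilterTheorem em zorn M distributive
  open Compactness em zorn M using (compact)
  open Density em M
  open MaximalPoints em zorn M
  open Logic em
  open Space L* _≐_ _⊑_ τOpen InL₊

  ⊑-isPartialOrder : IsPartialOrder _≐_ _⊑_
  ⊑-isPartialOrder = record
    { isPreorder = record
      { isEquivalence = record
        { refl = id , id
        ; sym = λ (x⊑y , y⊑x) → y⊑x , x⊑y
        ; trans = λ (x⊑y , y⊑x) (y⊑z , z⊑y) → (λ a → y⊑z (x⊑y a)) , (λ a → y⊑x (z⊑y a)) }
      ; reflexive = proj₁
      ; trans = λ x⊑y y⊑z a → y⊑z (x⊑y a) }
    ; antisym = _,_ }

  φ-clopenUpset : ∀ a → IsClopenUpset (φ a)
  φ-clopenUpset a = (Sub-open (inj₁ a) , Sub-open (inj₂ a)) , λ _ _ x⊑y xa → x⊑y xa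

  separation : ∀ x y → ¬ x ⊑ y → ∃ λ U → IsClopenUpset U × U x × ¬ U y
  separation x y x⋢y =
    let (a , xa , y∌a) = ¬⊆⇒∃ {P = proj₁ x} {Q = proj₁ y} x⋢y
    in φ a , φ-clopenUpset a , xa , y∌a

  φ-admissible : ∀ a → Admissible (φ a)
  φ-admissible a = φ-clopenUpset a , λ m (m∌a , maximal) →
    let (Q , Q-prime , m⊆Q , Q∌a) = prime-filter-theorem (optimal⇒filter m) m∌a
        (Q⊆m , _) = maximal (primePoint (Q , Q-prime)) Q∌a m⊆Q
    in IsPrimeFilter-resp-≐ Q⊆m m⊆Q Q-prime

  ⊑⇔admissible-⊆ : ∀ x y → (x ⊑ y) ⇔ (∀ U → Admissible U → U x → U y)
  ⊑⇔admissible-⊆ x y = mk⇔ (λ x⊑y U U-admissible Ux → proj₂ (proj₁ U-admissible) x y x⊑y Ux)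
                            (λ admissible-⊆ {a} xa → admissible-⊆ (φ a) (φ-admissible a) xa)

  below-prime : ∀ x → ∃ λ y → InL₊ y × x ⊑ y
  below-prime x =
    let (Q , Q-prime , x⊆Q , _) = prime-filter-theorem (optimal⇒filter x)
                                     (optimal-avoids-minimum (proj₂ bottom) x)
    in primePoint (Q , Q-prime) , Q-prime , x⊆Q

  -- U is compact, being closed, so finitely many φ a with a ∉ x cover it; x is
  -- prime, so these a have an upper bound outside x.
  clopenUpset⊆φ : ∀ {x U} → InL₊ x → IsClopenUpset U → ¬ U x → ∃ λ c → ¬ proj₁ x c × U ⊆ φ c
  clopenUpset⊆φ {x} {U} x-prime ((_ , ∁U-open) , U-upset) ¬Ux =
    let (Vs , 𝒰Vs , Vs-cover) = compact _ 𝒰 𝒰-open covers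
        (c , x∌c , U∩⋃Vs⊆φc) = bound Vs 𝒰Vs
    in c , x∌c , λ {y} Uy → U∩⋃Vs⊆φc y Uy (Vs-cover y)
    where
    𝒰 : Pred (Pred L* 0ℓ) _
    𝒰 V = V ≡ ∁ U ⊎ ∃ λ a → ¬ proj₁ x a × V ≡ φ a

    𝒰-open : ∀ V → 𝒰 V → τOpen V
    𝒰-open _ (inj₁ refl) = ∁U-open
    𝒰-open _ (inj₂ (a , _ , refl)) = Sub-open (inj₁ a)

    covers : ∀ y → ∃ λ V → 𝒰 V × V y
    covers y with em {P = U y}
    ... | no ¬Uy = ∁ U , inj₁ refl , ¬Uy
    ... | yes Uy =
      let (a , ya , x∌a) = ¬⊆⇒∃ {P = proj₁ y} {Q = proj₁ x} λ y⊑x → ¬Ux (U-upset y x y⊑x Uy)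
      in φ a , inj₂ (a , x∌a , refl) , ya

    bound : ∀ Vs → All 𝒰 Vs → ∃ λ c → ¬ proj₁ x c × (∀ y → U y → Any (λ V → V y) Vs → proj₁ y c)
    bound [] [] = proj₁ bottom , optimal-avoids-minimum (proj₂ bottom) x , λ _ _ ()
    bound (_ ∷ Vs) (inj₁ refl ∷ 𝒰Vs) =
      let (c , x∌c , c∈) = bound Vs 𝒰Vs
      in c , x∌c , λ { y Uy (here ¬Uy) → ⊥-elim (¬Uy Uy) ; y Uy (there y∈Vs) → c∈ y Uy y∈Vs }
    bound (_ ∷ Vs) (inj₂ (a , x∌a , refl) ∷ 𝒰Vs) =
      let (c , x∌c , c∈) = bound Vs 𝒰Vs
          (d , c≤d , a≤d , x∌d) = prime-avoids-upper-bound x-prime x∌c x∌a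
      in d , x∌d , λ { y Uy (here ya) → Filter.upward (optimal⇒filter y) a≤d ya
                     ; y Uy (there y∈Vs) → Filter.upward (optimal⇒filter y) c≤d (c∈ y Uy y∈Vs) }

  prime⇒directed : ∀ x → InL₊ x → IDirected x
  prime⇒directed x x-prime U V (U-admissible , ¬Ux) (V-admissible , ¬Vx) =
    let (c , x∌c , U⊆φc) = clopenUpset⊆φ x-prime (proj₁ U-admissible) ¬Ux
        (c′ , x∌c′ , V⊆φc′) = clopenUpset⊆φ x-prime (proj₁ V-admissible) ¬Vx
        (d , c≤d , c′≤d , x∌d) = prime-avoids-upper-bound x-prime x∌c x∌c′
    in φ d , (φ-admissible d , x∌d) ,
       (λ {y} Uy → Filter.upward (optimal⇒filter y) c≤d (U⊆φc Uy)) ,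
       (λ {y} Vy → Filter.upward (optimal⇒filter y) c′≤d (V⊆φc′ Vy))

  -- If a₁ ∈ F₁ and a₂ ∈ F₂ lie outside x, a common admissible W ⊇ φ a₁ ∪ φ a₂
  -- missing x has a maximal point m ⊒ x outside it; m is prime since W is
  -- admissible, so it contains F₁ or F₂, and then m ∈ W.
  directed⇒prime : ∀ x → IDirected x → InL₊ x
  directed⇒prime x directed =
    optimal⇒filter x , (λ x-all → optimal-avoids-minimum (proj₂ bottom) x (x-all _)) , prime
    where
    prime : ∀ F₁ F₂ → IsFilter F₁ → IsFilter F₂ → (λ a → F₁ a × F₂ a) ⊆ proj₁ x →
            (F₁ ⊆ proj₁ x) ⊎ (F₂ ⊆ proj₁ x)
    prime F₁ F₂ F₁-filter F₂-filter F₁∩F₂⊆x =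
      dne {P = (F₁ ⊆ proj₁ x) ⊎ (F₂ ⊆ proj₁ x)} λ neither →
        let (a₁ , F₁a₁ , x∌a₁) = ¬⊆⇒∃ {P = F₁} {Q = proj₁ x} λ F₁⊆x → neither (inj₁ F₁⊆x)
            (a₂ , F₂a₂ , x∌a₂) = ¬⊆⇒∃ {P = F₂} {Q = proj₁ x} λ F₂⊆x → neither (inj₂ F₂⊆x)
            (W , (W-admissible , ¬Wx) , φa₁⊆W , φa₂⊆W) =
              directed (φ a₁) (φ a₂) (φ-admissible a₁ , x∌a₁) (φ-admissible a₂ , x∌a₂)
            (m , x⊑m , m-maximal) = closed-maximal-above W (proj₁ (proj₁ (proj₁ W-admissible))) x ¬Wx
            (_ , _ , m-prime) = proj₂ W-admissible m m-maximal
        in [ (λ F₁⊆m → proj₁ m-maximal (φa₁⊆W (F₁⊆m F₁a₁)))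
           , (λ F₂⊆m → proj₁ m-maximal (φa₂⊆W (F₂⊆m F₂a₂))) ]′
           (m-prime F₁ F₂ F₁-filter F₂-filter λ F₁∩F₂ → x⊑m (F₁∩F₂⊆x F₁∩F₂))

  isGeneralizedPriestley : ∀ k → IsGenPriestley k
  isGeneralizedPriestley k =
    (compact k , ⊑-isPartialOrder , separation) ,
    prime-dense ,
    below-prime ,
    (λ x → mk⇔ (prime⇒directed x) (directed⇒prime x)) ,
    ⊑⇔admissible-⊆

proposition6p12 : (∀ {ℓ} → ExcludedMiddle ℓ) → (∀ {a r ℓ} → Zorn a r ℓ) →
    (M : BoundedMeetSemilattice 0ℓ 0ℓ 0ℓ) → SL.HasBottom M → SL.IsDistributive M →
    (k : Level) →
    Space.IsGenPriestley (SL.L* M) (SL._≐_ M) (SL._⊑_ M) (SL.τOpen M) (SL.InL₊ M) k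
proposition6p12 em zorn M bottom distributive =
  GeneralizedPriestley.isGeneralizedPriestley em zorn M bottom distributive
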